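{- Let $n\ge 2$ and let $i_1,\ldots,i_n$ be integers with $i_1,\ldots,i_n\ge 2^{2^{n-1}}$. Then ${\rm gp}(P_{i_1}\,\square\,\cdots\,\square\,P_{i_n}) = 2^{2^{n-1}}$.
   Context: $P_k$ denotes the path on $k$ vertices. The Cartesian product $X\,\square\,Y$ of graphs $X,Y$ has vertex set $V(X)\times V(Y)$, with $(x,y)$ adjacent to $(x',y')$ iff either $x=x'$ and $yy'\in E(Y)$, or $y=y'$ and $xx'\in E(X)$. For a connected graph $G$, a set $S\subseteq V(G)$ is a general position set if $d_G(u,v)\neq d_G(u,w)+d_G(w,v)$ for every three pairwise distinct $u,v,w\in S$, where $d_G$ is the shortest-path distance; ${\rm gp}(G)$ is the maximum cardinality of a general position set of $G$. -}

module Defs where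

open import Data.Nat using (ℕ; zero; suc; _+_; _<_; _≤_)
open import Data.Vec using (Vec; []; _∷_)
open import Data.List using (List; length)
open import Data.List.Membership.Propositional using (_∈_)
open import Data.List.Relation.Unary.All using (All)
open import Data.List.Relation.Unary.Unique.Propositional using (Unique)
open import Data.Product using (Σ; _×_; ∃)
open import Data.Sum using (_⊎_)
open import Data.Empty using (⊥)
open import Relation.Nullary using (¬_)
open import Relation.Binary.PropositionalEquality using (_≡_; _≢_)

-- The grid P_{i_1} □ ⋯ □ P_{i_n}, given by the size vector is = (i_1,…,i_n).
-- Vertices of P_i are 0,…,i-1; vertices of the product are vectors x with x_k < i_k.

InGrid : ∀ {n} → Vec ℕ n → Vec ℕ n → Set
InGrid []       []       = Data.Unit.⊤ where import Data.Unit
InGrid (i ∷ is) (x ∷ xs) = x < i × InGrid is xs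

PathAdj : ℕ → ℕ → ℕ → Set
PathAdj i x y = x < i × y < i × (suc x ≡ y ⊎ suc y ≡ x)

-- adjacency in P_{i_1} □ (P_{i_2} □ ⋯ □ P_{i_n}), following the definition of
-- the Cartesian product; the empty product is K_1 (no edges).
Adj : ∀ {n} → Vec ℕ n → Vec ℕ n → Vec ℕ n → Set
Adj []       []       []       = ⊥
Adj (i ∷ is) (x ∷ xs) (y ∷ ys) =
  (x ≡ y × x < i × Adj is xs ys) ⊎ (xs ≡ ys × InGrid is xs × PathAdj i x y)

data Walk {n} (is : Vec ℕ n) : Vec ℕ n → Vec ℕ n → ℕ → Set where
  here : ∀ {u} → InGrid is u → Walk is u u zero
  step : ∀ {u w v k} → Adj is u w → Walk is w v k → Walk is u v (suc k)

Dist : ∀ {n} → Vec ℕ n → Vec ℕ n → Vec ℕ n → ℕ → Set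
Dist is u v m = Walk is u v m × (∀ k → Walk is u v k → m ≤ k)

IsGPSet : ∀ {n} → Vec ℕ n → List (Vec ℕ n) → Set
IsGPSet is S =
  All (InGrid is) S × Unique S ×
  (∀ {u v w} → u ∈ S → v ∈ S → w ∈ S → u ≢ v → u ≢ w → v ≢ w →
     ∀ {duv duw dwv} → Dist is u v duv → Dist is u w duw → Dist is w v dwv →
     duv ≢ duw + dwv)

GpEq : ∀ {n} → Vec ℕ n → ℕ → Set
GpEq is N =
  (Σ (List _) λ S → IsGPSet is S × length S ≡ N) ×
  (∀ S → IsGPSet is S → length S ≤ N)

-- In a grid the graph distance is the ℓ₁ distance, so three vertices fail to be in
-- general position exactly when one of them lies coordinatewise between the other two.
--
-- Upper bound: sort a general position set of the (d+1)-dimensional grid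
-- lexicographically, so that the first coordinate is monotone along the list. By
-- Erdős–Szekeres, a list longer than N² has a sublist longer than N on which a given
-- coordinate is monotone; applied to the remaining d coordinates in turn, more than
-- 2^(2^d) points leave three points monotone in every coordinate, a contradiction.
--
-- Lower bound: with N = 2^(2^d) and t < N² written in base N with digits q, m, the
-- point of t has coordinates t, (N-1-q)N + m, and the digitwise combinations of the
-- points of q and m one dimension lower. In a between triple of such points, two high
-- digits cannot agree unless all three do, because the first two coordinates would order
-- the low digits in opposite ways; so the high digits, or else the low digits, index a
-- between triple one dimension lower.

module Submission where

open import Defs
open import Data.Nat using (ℕ; _≤_; _^_; _∸_)
open import Data.Vec using (Vec)
open import Data.Vec.Relation.Unary.All using (All)

open import Data.Empty using (⊥)
open import Data.List using (List; []; _∷_; length; map; filter; upTo)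
open import Data.List.Membership.Propositional using (_∈_)
open import Data.List.Membership.Propositional.Properties using (∈-map⁻; ∈-upTo⁻)
open import Data.List.Properties using (length-map; length-upTo)
open import Data.List.Relation.Binary.Permutation.Propositional using (↭-sym; ↭⇒↭ₛ)
open import Data.List.Relation.Binary.Permutation.Propositional.Properties using (∈-resp-↭; ↭-length)
import Data.List.Relation.Binary.Permutation.Setoid.Properties as Permutationₛ
open import Data.List.Relation.Binary.Sublist.Propositional using (_⊆_; []; _∷_; _∷ʳ_; ⊆-trans; minimum)
open import Data.List.Relation.Binary.Sublist.Propositional.Properties
  using (All-resp-⊆; Any-resp-⊆; filter-⊆) renaming (map⁺ to map⁺-⊆)
open import Data.List.Relation.Unary.All as ListAll using ([]; _∷_)
open import Data.List.Relation.Unary.All.Properties using (all-filter) renaming (filter⁺ to filter⁺-All; map⁺ to map⁺-All)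
open import Data.List.Relation.Unary.AllPairs as AllPairs using (AllPairs; []; _∷_)
open import Data.List.Relation.Unary.Any using (here; there)
import Data.List.Relation.Unary.Sorted.TotalOrder.Properties as Sorted
open import Data.List.Relation.Unary.Unique.Propositional using (Unique)
import Data.List.Relation.Unary.Unique.Propositional.Properties as Unique
import Data.List.Sort as Sort
open import Data.Nat using (zero; suc; _+_; _*_; _<_; _⊔_; _/_; _%_; _≤?_; _<?_; _≟_; z≤n; s≤s; s≤s⁻¹; ∣_-_∣; NonZero)
open import Data.Nat.DivMod using (m≡m%n+[m/n]*n; m%n<n; m<n*o⇒m/o<n)
open import Data.Nat.Properties
open import Algebra.Properties.CommutativeSemigroup +-commutativeSemigroup using (interchange)
open import Data.Product using (∃; ∃₂; _×_; _,_; proj₁; proj₂)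
open import Data.Sum using (_⊎_; inj₁; inj₂)
open import Data.Unit using (⊤; tt)
open import Data.Vec using ([]; _∷_; head; tail; zipWith)
import Data.Vec.Relation.Binary.Lex.NonStrict as Lex
open import Data.Vec.Relation.Unary.All using ([]; _∷_)
open import Function using (_∘_)
open import Relation.Binary.Bundles using (DecTotalOrder)
open import Relation.Binary.Definitions using (Decidable; Transitive; tri<; tri≈; tri>)
open import Relation.Binary.PropositionalEquality
  using (_≡_; _≢_; refl; sym; trans; cong; cong₂; subst; subst₂; setoid; ≢-sym; module ≡-Reasoning)
open import Relation.Nullary using (¬_; yes; no; contradiction)
open import Relation.Unary using () renaming (Decidable to Decidable₁)
open import Relation.Unary.Properties using (∁?)

-- Distance in a grid

d₁ : ∀ {n} → Vec ℕ n → Vec ℕ n → ℕ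
d₁ []       []       = 0
d₁ (x ∷ xs) (y ∷ ys) = ∣ x - y ∣ + d₁ xs ys

d₁-self : ∀ {n} (u : Vec ℕ n) → d₁ u u ≡ 0
d₁-self []       = refl
d₁-self (x ∷ xs) rewrite ∣n-n∣≡0 x = d₁-self xs

d₁-triangle : ∀ {n} (u w v : Vec ℕ n) → d₁ u v ≤ d₁ u w + d₁ w v
d₁-triangle []       []       []       = z≤n
d₁-triangle (x ∷ xs) (z ∷ zs) (y ∷ ys) = ≤-trans
  (+-mono-≤ (∣-∣-triangle x z y) (d₁-triangle xs zs ys))
  (≤-reflexive (interchange ∣ x - z ∣ ∣ z - y ∣ (d₁ xs zs) (d₁ zs ys)))

∣n-1+n∣≡1 : ∀ n → ∣ n - suc n ∣ ≡ 1
∣n-1+n∣≡1 zero    = refl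
∣n-1+n∣≡1 (suc n) = ∣n-1+n∣≡1 n

Adj⇒d₁≤1 : ∀ {n} {is u w : Vec ℕ n} → Adj is u w → d₁ u w ≤ 1
Adj⇒d₁≤1 {is = []}    {[]}     {[]}     ()
Adj⇒d₁≤1 {is = _ ∷ _} {x ∷ _}  {_ ∷ _}  (inj₁ (refl , _ , adj)) rewrite ∣n-n∣≡0 x = Adj⇒d₁≤1 adj
Adj⇒d₁≤1 {is = _ ∷ _} {x ∷ xs} {_ ∷ _}  (inj₂ (refl , _ , _ , _ , inj₁ refl))
  rewrite ∣n-1+n∣≡1 x | d₁-self xs = ≤-refl
Adj⇒d₁≤1 {is = _ ∷ _} {_ ∷ xs} {y ∷ _}  (inj₂ (refl , _ , _ , _ , inj₂ refl))
  rewrite ∣-∣-comm (suc y) y | ∣n-1+n∣≡1 y | d₁-self xs = ≤-refl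

Walk⇒d₁≤length : ∀ {n} {is u v : Vec ℕ n} {k} → Walk is u v k → d₁ u v ≤ k
Walk⇒d₁≤length {u = u} (here _) rewrite d₁-self u = z≤n
Walk⇒d₁≤length {u = u} {v} (step {w = w} adj walk) =
  ≤-trans (d₁-triangle u w v) (+-mono-≤ (Adj⇒d₁≤1 adj) (Walk⇒d₁≤length walk))

walk-++ : ∀ {n} {is u w v : Vec ℕ n} {k l} → Walk is u w k → Walk is w v l → Walk is u v (k + l)
walk-++ (here _)        walk′ = walk′
walk-++ (step adj walk) walk′ = step adj (walk-++ walk walk′)

walk-∷ : ∀ {n i} {is xs ys : Vec ℕ n} {x k} → x < i → Walk is xs ys k → Walk (i ∷ is) (x ∷ xs) (x ∷ ys) k
walk-∷ x<i (here g)        = here (x<i , g)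
walk-∷ x<i (step adj walk) = step (inj₁ (refl , x<i , adj)) (walk-∷ x<i walk)

module _ {n} {i : ℕ} {is xs : Vec ℕ n} (g : InGrid is xs) where

  walk-up : ∀ k x → k + x < i → Walk (i ∷ is) (x ∷ xs) (k + x ∷ xs) k
  walk-up zero    x k+x<i = here (k+x<i , g)
  walk-up (suc k) x k+x<i = step
    (inj₂ (refl , g , ≤-trans (s≤s (m≤n+m x (suc k))) k+x<i , ≤-trans (s≤s (s≤s (m≤n+m x k))) k+x<i , inj₁ refl))
    (subst (λ y → Walk (i ∷ is) (suc x ∷ xs) (y ∷ xs) k) (+-suc k x)
      (walk-up k (suc x) (subst (_< i) (sym (+-suc k x)) k+x<i)))

  walk-down : ∀ k x → k + x < i → Walk (i ∷ is) (k + x ∷ xs) (x ∷ xs) k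
  walk-down zero    x k+x<i = here (k+x<i , g)
  walk-down (suc k) x k+x<i =
    step (inj₂ (refl , g , k+x<i , ≤-trans (n≤1+n _) k+x<i , inj₂ refl)) (walk-down k x (≤-trans (n≤1+n _) k+x<i))

  walk-axis : ∀ {x y} → x < i → y < i → Walk (i ∷ is) (x ∷ xs) (y ∷ xs) ∣ x - y ∣
  walk-axis {x} {y} x<i y<i with ≤-total x y
  ... | inj₁ x≤y = subst₂ (λ z k → Walk (i ∷ is) (x ∷ xs) (z ∷ xs) k) (m∸n+n≡m x≤y) (sym (m≤n⇒∣m-n∣≡n∸m x≤y))
                     (walk-up (y ∸ x) x (subst (_< i) (sym (m∸n+n≡m x≤y)) y<i))
  ... | inj₂ y≤x = subst₂ (λ z k → Walk (i ∷ is) (z ∷ xs) (y ∷ xs) k) (m∸n+n≡m y≤x) (sym (m≤n⇒∣n-m∣≡n∸m y≤x))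
                     (walk-down (x ∸ y) y (subst (_< i) (sym (m∸n+n≡m y≤x)) x<i))

geodesic : ∀ {n} {is u v : Vec ℕ n} → InGrid is u → InGrid is v → Walk is u v (d₁ u v)
geodesic {is = []}    {[]}     {[]}     _          _          = here tt
geodesic {is = _ ∷ _} {_ ∷ _}  {_ ∷ _}  (x<i , gx) (y<i , gy) = walk-++ (walk-axis gx x<i y<i) (walk-∷ y<i (geodesic gx gy))

Dist-d₁ : ∀ {n} {is u v : Vec ℕ n} → InGrid is u → InGrid is v → Dist is u v (d₁ u v)
Dist-d₁ gu gv = geodesic gu gv , λ _ → Walk⇒d₁≤length

Dist⇒≡d₁ : ∀ {n} {is u v : Vec ℕ n} {m} → InGrid is u → InGrid is v → Dist is u v m → m ≡ d₁ u v
Dist⇒≡d₁ gu gv (walk , shortest) = ≤-antisym (shortest _ (geodesic gu gv)) (Walk⇒d₁≤length walk)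

-- Betweenness

Between : ℕ → ℕ → ℕ → Set
Between a b c = (a ≤ b × b ≤ c) ⊎ (c ≤ b × b ≤ a)

Between-sym : ∀ {a b c} → Between a b c → Between c b a
Between-sym (inj₁ (a≤b , b≤c)) = inj₂ (a≤b , b≤c)
Between-sym (inj₂ (c≤b , b≤a)) = inj₁ (c≤b , b≤a)

Between-outer-≡ : ∀ {a b} → Between a b a → b ≡ a
Between-outer-≡ (inj₁ (a≤b , b≤a)) = ≤-antisym b≤a a≤b
Between-outer-≡ (inj₂ (a≤b , b≤a)) = ≤-antisym b≤a a≤b

∸-split : ∀ {a b c} → a ≤ b → b ≤ c → c ∸ a ≡ (b ∸ a) + (c ∸ b)
∸-split {a} {b} {c} a≤b b≤c = begin
  c ∸ a                 ≡⟨ cong (_∸ a) (sym (m∸n+n≡m b≤c)) ⟩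
  (c ∸ b) + b ∸ a       ≡⟨ +-∸-assoc (c ∸ b) a≤b ⟩
  (c ∸ b) + (b ∸ a)     ≡⟨ +-comm (c ∸ b) (b ∸ a) ⟩
  (b ∸ a) + (c ∸ b)     ∎
  where open ≡-Reasoning

Between⇒∣-∣-additive : ∀ {a b c} → Between a b c → ∣ a - c ∣ ≡ ∣ a - b ∣ + ∣ b - c ∣
Between⇒∣-∣-additive (inj₁ (a≤b , b≤c))
  rewrite m≤n⇒∣m-n∣≡n∸m (≤-trans a≤b b≤c) | m≤n⇒∣m-n∣≡n∸m a≤b | m≤n⇒∣m-n∣≡n∸m b≤c = ∸-split a≤b b≤c
Between⇒∣-∣-additive {a} {b} {c} (inj₂ (c≤b , b≤a))
  rewrite m≤n⇒∣n-m∣≡n∸m (≤-trans c≤b b≤a) | m≤n⇒∣n-m∣≡n∸m c≤b | m≤n⇒∣n-m∣≡n∸m b≤a =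
  trans (∸-split c≤b b≤a) (+-comm (b ∸ c) (a ∸ b))

m+[n∸o]≤m⇒n≤o : ∀ m n o → m + (n ∸ o) ≤ m → n ≤ o
m+[n∸o]≤m⇒n≤o m n o le =
  m∸n≡0⇒m≤n (n≤0⇒n≡0 (+-cancelˡ-≤ m (n ∸ o) 0 (≤-trans le (≤-reflexive (sym (+-identityʳ m))))))

∣-∣-additive⇒ordered : ∀ {a b c} → a ≤ c → ∣ a - c ∣ ≡ ∣ a - b ∣ + ∣ b - c ∣ → a ≤ b × b ≤ c
∣-∣-additive⇒ordered {a} {b} {c} a≤c eq with ≤-total a b | ≤-total b c
... | inj₁ a≤b | inj₁ b≤c = a≤b , b≤c
... | inj₂ b≤a | inj₂ c≤b = ≤-trans a≤c c≤b , ≤-trans b≤a a≤c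
... | inj₁ a≤b | inj₂ c≤b = a≤b , m+[n∸o]≤m⇒n≤o (b ∸ a) b c (begin
  (b ∸ a) + (b ∸ c)   ≡⟨ cong₂ _+_ (sym (m≤n⇒∣m-n∣≡n∸m a≤b)) (sym (m≤n⇒∣n-m∣≡n∸m c≤b)) ⟩
  ∣ a - b ∣ + ∣ b - c ∣ ≡⟨ sym eq ⟩
  ∣ a - c ∣           ≡⟨ m≤n⇒∣m-n∣≡n∸m a≤c ⟩
  c ∸ a               ≤⟨ ∸-monoˡ-≤ a c≤b ⟩
  b ∸ a               ∎)
  where open ≤-Reasoning
... | inj₂ b≤a | inj₁ b≤c = m+[n∸o]≤m⇒n≤o (c ∸ b) a b (begin
  (c ∸ b) + (a ∸ b)   ≡⟨ +-comm (c ∸ b) (a ∸ b) ⟩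
  (a ∸ b) + (c ∸ b)   ≡⟨ cong₂ _+_ (sym (m≤n⇒∣n-m∣≡n∸m b≤a)) (sym (m≤n⇒∣m-n∣≡n∸m b≤c)) ⟩
  ∣ a - b ∣ + ∣ b - c ∣ ≡⟨ sym eq ⟩
  ∣ a - c ∣           ≡⟨ m≤n⇒∣m-n∣≡n∸m a≤c ⟩
  c ∸ a               ≤⟨ ∸-monoʳ-≤ c b≤a ⟩
  c ∸ b               ∎) , b≤c
  where open ≤-Reasoning

∣-∣-additive⇒Between : ∀ {a b c} → ∣ a - c ∣ ≡ ∣ a - b ∣ + ∣ b - c ∣ → Between a b c
∣-∣-additive⇒Between {a} {b} {c} eq with ≤-total a c
... | inj₁ a≤c = inj₁ (∣-∣-additive⇒ordered a≤c eq)
... | inj₂ c≤a = Between-sym (inj₁ (∣-∣-additive⇒ordered c≤a (begin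
  ∣ c - a ∣             ≡⟨ ∣-∣-comm c a ⟩
  ∣ a - c ∣             ≡⟨ eq ⟩
  ∣ a - b ∣ + ∣ b - c ∣ ≡⟨ cong₂ _+_ (∣-∣-comm a b) (∣-∣-comm b c) ⟩
  ∣ b - a ∣ + ∣ c - b ∣ ≡⟨ +-comm ∣ b - a ∣ ∣ c - b ∣ ⟩
  ∣ c - b ∣ + ∣ b - a ∣ ∎)))
  where open ≡-Reasoning

AllBetween : ∀ {n} → Vec ℕ n → Vec ℕ n → Vec ℕ n → Set
AllBetween {zero}  _ _ _ = ⊤
AllBetween {suc n} u w v = Between (head u) (head w) (head v) × AllBetween (tail u) (tail w) (tail v)

AllBetween⇒d₁-additive : ∀ {n} (u w v : Vec ℕ n) → AllBetween u w v → d₁ u v ≡ d₁ u w + d₁ w v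
AllBetween⇒d₁-additive []       []       []       _          = refl
AllBetween⇒d₁-additive (a ∷ as) (b ∷ bs) (c ∷ cs) (abc , abcs) = trans
  (cong₂ _+_ (Between⇒∣-∣-additive abc) (AllBetween⇒d₁-additive as bs cs abcs))
  (interchange ∣ a - b ∣ ∣ b - c ∣ (d₁ as bs) (d₁ bs cs))

m+o≡n+p⇒m≡n : ∀ {m n o p} → m ≤ n → o ≤ p → m + o ≡ n + p → m ≡ n
m+o≡n+p⇒m≡n m≤n o≤p eq with m≤n⇒m<n∨m≡n m≤n
... | inj₂ m≡n = m≡n
... | inj₁ m<n = contradiction eq (<⇒≢ (+-mono-<-≤ m<n o≤p))

d₁-additive⇒AllBetween : ∀ {n} (u w v : Vec ℕ n) → d₁ u v ≡ d₁ u w + d₁ w v → AllBetween u w v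
d₁-additive⇒AllBetween []       []       []       _  = tt
d₁-additive⇒AllBetween (a ∷ as) (b ∷ bs) (c ∷ cs) eq =
  ∣-∣-additive⇒Between head-eq , d₁-additive⇒AllBetween as bs cs (+-cancelˡ-≡ ∣ a - c ∣ _ _ tail-eq)
  where
  split-eq : ∣ a - c ∣ + d₁ as cs ≡ (∣ a - b ∣ + ∣ b - c ∣) + (d₁ as bs + d₁ bs cs)
  split-eq = trans eq (interchange ∣ a - b ∣ (d₁ as bs) ∣ b - c ∣ (d₁ bs cs))
  head-eq : ∣ a - c ∣ ≡ ∣ a - b ∣ + ∣ b - c ∣
  head-eq = m+o≡n+p⇒m≡n (∣-∣-triangle a b c) (d₁-triangle as bs cs) split-eq
  tail-eq : ∣ a - c ∣ + d₁ as cs ≡ ∣ a - c ∣ + (d₁ as bs + d₁ bs cs)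
  tail-eq = trans split-eq (cong (_+ _) (sym head-eq))

-- General position sets of a grid

BetweenFree : ∀ {n} → List (Vec ℕ n) → Set
BetweenFree S = ∀ {u w v} → u ∈ S → w ∈ S → v ∈ S → u ≢ w → u ≢ v → w ≢ v → ¬ AllBetween u w v

module _ {n} {is : Vec ℕ n} {S : List (Vec ℕ n)} where

  IsGPSet⇒BetweenFree : IsGPSet is S → BetweenFree S
  IsGPSet⇒BetweenFree (inGrid , _ , gp) {u} {w} {v} u∈S w∈S v∈S u≢w u≢v w≢v uwv =
    gp u∈S v∈S w∈S u≢v u≢w (≢-sym w≢v) (Dist-d₁ gu gv) (Dist-d₁ gu gw) (Dist-d₁ gw gv)
       (AllBetween⇒d₁-additive u w v uwv)
    where
    gu = ListAll.lookup inGrid u∈S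
    gw = ListAll.lookup inGrid w∈S
    gv = ListAll.lookup inGrid v∈S

  BetweenFree⇒IsGPSet : ListAll.All (InGrid is) S → Unique S → BetweenFree S → IsGPSet is S
  BetweenFree⇒IsGPSet inGrid unique betweenFree =
    inGrid , unique , λ {u} {v} {w} u∈S v∈S w∈S u≢v u≢w v≢w {duv} {duw} {dwv} Duv Duw Dwv eq →
      let gu = ListAll.lookup inGrid u∈S
          gw = ListAll.lookup inGrid w∈S
          gv = ListAll.lookup inGrid v∈S
      in betweenFree u∈S w∈S v∈S u≢w u≢v (≢-sym v≢w) (d₁-additive⇒AllBetween u w v (begin
        d₁ u v          ≡⟨ sym (Dist⇒≡d₁ gu gv Duv) ⟩
        duv             ≡⟨ eq ⟩
        duw + dwv       ≡⟨ cong₂ _+_ (Dist⇒≡d₁ gu gw Duw) (Dist⇒≡d₁ gw gv Dwv) ⟩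
        d₁ u w + d₁ w v ∎))
    where open ≡-Reasoning

-- Erdős–Szekeres

AllPairs-resp-⊆ : ∀ {A : Set} {R : A → A → Set} {xs ys : List A} → xs ⊆ ys → AllPairs R ys → AllPairs R xs
AllPairs-resp-⊆ []         []         = []
AllPairs-resp-⊆ (_ ∷ʳ τ)   (_ ∷ rys)  = AllPairs-resp-⊆ τ rys
AllPairs-resp-⊆ (refl ∷ τ) (ry ∷ rys) = All-resp-⊆ τ ry ∷ AllPairs-resp-⊆ τ rys

module _ {B : Set} {Q : B → Set} (Q? : Decidable₁ Q) where

  length-filter+length-filter-∁ : ∀ xs → length (filter Q? xs) + length (filter (∁? Q?) xs) ≡ length xs
  length-filter+length-filter-∁ []       = refl
  length-filter+length-filter-∁ (x ∷ xs) with Q? x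
  ... | yes _ = cong suc (length-filter+length-filter-∁ xs)
  ... | no  _ = trans (+-suc _ _) (cong suc (length-filter+length-filter-∁ xs))

module _ {B : Set} (f : B → ℕ) where

  label≟ : ∀ c → Decidable₁ (λ x → f x ≡ c)
  label≟ c x = f x ≟ c

  pigeonhole : ∀ r s (xs : List B) → ListAll.All (λ x → f x < r) xs → r * s < length xs →
    ∃₂ λ c ys → ys ⊆ xs × ListAll.All (λ y → f y ≡ c) ys × s < length ys
  pigeonhole zero    s []      []       ()
  pigeonhole zero    s (_ ∷ _) (() ∷ _) _
  pigeonhole (suc r) s xs bounded big with s <? length (filter (label≟ r) xs)
  ... | yes many = r , _ , filter-⊆ (label≟ r) xs , all-filter (label≟ r) xs , many
  ... | no few =
    let c , ys , ys⊆rest , ys≡c , many = pigeonhole r s rest rest-bounded rest-big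
    in c , ys , ⊆-trans ys⊆rest (filter-⊆ (∁? (label≟ r)) xs) , ys≡c , many
    where
    rest = filter (∁? (label≟ r)) xs
    rest-bounded : ListAll.All (λ x → f x < r) rest
    rest-bounded = ListAll.zipWith (λ (fx<1+r , fx≢r) → ≤∧≢⇒< (s≤s⁻¹ fx<1+r) fx≢r)
      (filter⁺-All (∁? (label≟ r)) bounded , all-filter (∁? (label≟ r)) xs)
    rest-big : r * s < length rest
    rest-big = +-cancelˡ-< s (r * s) (length rest) (begin-strict
      s + r * s                                   <⟨ big ⟩
      length xs                                   ≡⟨ sym (length-filter+length-filter-∁ (label≟ r) xs) ⟩
      length (filter (label≟ r) xs) + length rest ≤⟨ +-monoˡ-≤ (length rest) (≮⇒≥ few) ⟩
      s + length rest                             ∎)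
      where open ≤-Reasoning

module ErdősSzekeres {A : Set} {P : A → A → Set} (P? : Decidable P) (P-trans : Transitive P) where

  -- height x xs is the length of a longest P-chain in xs whose elements are all P-above x.
  height : A → List A → ℕ
  height x []       = 0
  height x (y ∷ ys) with P? x y
  ... | yes _ = suc (height y ys) ⊔ height x ys
  ... | no  _ = height x ys

  chain-above : ∀ x xs → ∃ λ C → C ⊆ xs × AllPairs P (x ∷ C) × height x xs ≤ length C
  chain-above x []       = [] , [] , [] ∷ [] , z≤n
  chain-above x (y ∷ ys) with P? x y
  ... | no _ = let C , C⊆ys , chain , height≤ = chain-above x ys in C , y ∷ʳ C⊆ys , chain , height≤
  ... | yes xPy with chain-above y ys | chain-above x ys | ≤-total (height x ys) (suc (height y ys))
  ...   | C , C⊆ys , chain , height≤ | _ | inj₁ shorter =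
    y ∷ C , refl ∷ C⊆ys , (xPy ∷ ListAll.map (P-trans xPy) (AllPairs.head chain)) ∷ chain ,
    ⊔-lub (s≤s height≤) (≤-trans shorter (s≤s height≤))
  ...   | _ | C , C⊆ys , chain , height≤ | inj₂ longer =
    C , y ∷ʳ C⊆ys , chain , ⊔-lub (≤-trans longer height≤) height≤

  height-mono : ∀ x y ys → height x ys ≤ height x (y ∷ ys)
  height-mono x y ys with P? x y
  ... | yes _ = m≤n⊔m (suc (height y ys)) (height x ys)
  ... | no  _ = ≤-refl

  labelled : List A → List (ℕ × A)
  labelled []       = []
  labelled (x ∷ xs) = (height x xs , x) ∷ labelled xs

  unlabel-labelled : ∀ xs → map proj₂ (labelled xs) ≡ xs
  unlabel-labelled []       = refl
  unlabel-labelled (x ∷ xs) = cong (x ∷_) (unlabel-labelled xs)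

  Descending : ℕ × A → ℕ × A → Set
  Descending (c , x) (c′ , y) = P x y → c′ < c

  height-above : ∀ {x xs c y} → (c , y) ∈ labelled xs → P x y → c < height x xs
  height-above {x} {z ∷ zs} (here refl) xPz with P? x z
  ... | yes _   = m≤m⊔n (suc (height z zs)) (height x zs)
  ... | no ¬xPz = contradiction xPz ¬xPz
  height-above {x} {z ∷ zs} (there cy∈) xPy = <-≤-trans (height-above cy∈ xPy) (height-mono x z zs)

  labelled-descending : ∀ xs → AllPairs Descending (labelled xs)
  labelled-descending []       = []
  labelled-descending (x ∷ xs) = ListAll.tabulate height-above ∷ labelled-descending xs

  chain-or-bounded : ∀ r xs → (∃ λ C → C ⊆ xs × r < length C × AllPairs P C) ⊎ ListAll.All (λ b → proj₁ b < r) (labelled xs)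
  chain-or-bounded r []       = inj₂ []
  chain-or-bounded r (x ∷ xs) with r ≤? height x xs
  ... | yes tall = let C , C⊆xs , chain , height≤ = chain-above x xs
                   in inj₁ (x ∷ C , refl ∷ C⊆xs , s≤s (≤-trans tall height≤) , chain)
  ... | no short with chain-or-bounded r xs
  ...   | inj₁ (C , C⊆xs , long , chain) = inj₁ (C , x ∷ʳ C⊆xs , long , chain)
  ...   | inj₂ bounded                   = inj₂ (≰⇒> short ∷ bounded)

  equal-labels-antichain : ∀ {c ys} → ListAll.All (λ b → proj₁ b ≡ c) ys → AllPairs Descending ys →
    AllPairs (λ x y → ¬ P x y) (map proj₂ ys)
  equal-labels-antichain []            []             = []
  equal-labels-antichain (refl ∷ same) (desc ∷ descs) =
    map⁺-All (ListAll.zipWith (λ (label≡c , descending) xPy → <-irrefl label≡c (descending xPy)) (same , desc))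
    ∷ equal-labels-antichain same descs

  erdős-szekeres : ∀ r s xs → r * s < length xs →
    (∃ λ C → C ⊆ xs × r < length C × AllPairs P C) ⊎
    (∃ λ C → C ⊆ xs × s < length C × AllPairs (λ x y → ¬ P x y) C)
  erdős-szekeres r s xs big with chain-or-bounded r xs
  ... | inj₁ chain   = inj₁ chain
  ... | inj₂ bounded =
    let c , ys , ys⊆ , same , long = pigeonhole proj₁ r s (labelled xs) bounded (subst (r * s <_) length-labelled big)
    in inj₂ (map proj₂ ys , subst (map proj₂ ys ⊆_) (unlabel-labelled xs) (map⁺-⊆ proj₂ ys⊆) ,
             subst (s <_) (sym (length-map proj₂ ys)) long ,
             equal-labels-antichain same (AllPairs-resp-⊆ ys⊆ (labelled-descending xs)))
    where
    length-labelled : length xs ≡ length (labelled xs)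
    length-labelled = trans (cong length (sym (unlabel-labelled xs))) (length-map proj₂ (labelled xs))

-- Upper bound

side : ℕ → ℕ
side zero    = 2
side (suc d) = side d * side d

side≡2^2^d : ∀ d → side d ≡ 2 ^ 2 ^ d
side≡2^2^d zero    = refl
side≡2^2^d (suc d) = begin
  side d * side d           ≡⟨ cong₂ _*_ (side≡2^2^d d) (side≡2^2^d d) ⟩
  2 ^ 2 ^ d * 2 ^ 2 ^ d     ≡⟨ sym (^-distribˡ-+-* 2 (2 ^ d) (2 ^ d)) ⟩
  2 ^ (2 ^ d + 2 ^ d)       ≡⟨ cong (λ k → 2 ^ (2 ^ d + k)) (sym (+-identityʳ (2 ^ d))) ⟩
  2 ^ 2 ^ suc d             ∎
  where open ≡-Reasoning

triple-pairs : ∀ {A : Set} {R : A → A → Set} {x y z} → AllPairs R (x ∷ y ∷ z ∷ []) → R x y × R x z × R y z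
triple-pairs ((xRy ∷ xRz ∷ []) ∷ (yRz ∷ []) ∷ [] ∷ []) = xRy , xRz , yRz

between-triple : ∀ {B : Set} d (π : B → Vec ℕ d) (xs : List B) → side d < length xs →
  ∃₂ λ x y → ∃ λ z → x ∷ y ∷ z ∷ [] ⊆ xs × AllBetween (π x) (π y) (π z)
between-triple zero    π (x ∷ y ∷ z ∷ xs) _ = x , y , z , refl ∷ refl ∷ refl ∷ minimum xs , tt
between-triple zero    π (_ ∷ [])          (s≤s ())
between-triple zero    π (_ ∷ _ ∷ [])      (s≤s (s≤s ()))
between-triple (suc d) π xs big
  with ErdősSzekeres.erdős-szekeres (λ x y → head (π x) ≤? head (π y)) ≤-trans (side d) (side d) xs big
... | inj₁ (C , C⊆xs , long , ascending) =
  let x , y , z , xyz⊆C , between = between-triple d (tail ∘ π) C long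
      x≤y , _ , y≤z = triple-pairs (AllPairs-resp-⊆ xyz⊆C ascending)
  in x , y , z , ⊆-trans xyz⊆C C⊆xs , inj₁ (x≤y , y≤z) , between
... | inj₂ (C , C⊆xs , long , descending) =
  let x , y , z , xyz⊆C , between = between-triple d (tail ∘ π) C long
      x≰y , _ , y≰z = triple-pairs (AllPairs-resp-⊆ xyz⊆C descending)
  in x , y , z , ⊆-trans xyz⊆C C⊆xs , inj₂ (≰⇒≥ y≰z , ≰⇒≥ x≰y) , between

lex-≤⇒head-≤ : ∀ {n} {u v : Vec ℕ (suc n)} → Lex.Lex-≤ _≡_ _≤_ u v → head u ≤ head v
lex-≤⇒head-≤ (Lex.this (x≤y , _) _) = x≤y
lex-≤⇒head-≤ (Lex.next refl _)      = ≤-refl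

gp-upper : ∀ d {is : Vec ℕ (suc d)} {S} → IsGPSet is S → length S ≤ side d
gp-upper d {S = S} gpS@(_ , unique , _) = ≮⇒≥ λ big →
  let x , y , z , xyz⊆ , between = between-triple d tail (sort S) (subst (side d <_) (sym (↭-length (sort-↭ S))) big)
      x≤y , _ , y≤z = triple-pairs (AllPairs-resp-⊆ xyz⊆ heads-ascending)
      x≢y , x≢z , y≢z = triple-pairs (AllPairs-resp-⊆ xyz⊆ distinct)
      member : ∀ {u} → u ∈ x ∷ y ∷ z ∷ [] → u ∈ S
      member u∈ = ∈-resp-↭ (sort-↭ S) (Any-resp-⊆ xyz⊆ u∈)
  in IsGPSet⇒BetweenFree gpS (member (here refl)) (member (there (here refl))) (member (there (there (here refl))))
       x≢y x≢z y≢z (inj₁ (x≤y , y≤z) , between)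
  where
  lexOrder = Lex.≤-decTotalOrder ≤-decTotalOrder (suc d)
  open Sort lexOrder using (sort; sort-↭; sort-↗)
  heads-ascending : AllPairs (λ u v → head u ≤ head v) (sort S)
  heads-ascending = AllPairs.map lex-≤⇒head-≤ (Sorted.Sorted⇒AllPairs (DecTotalOrder.totalOrder lexOrder) (sort-↗ S))
  distinct : AllPairs _≢_ (sort S)
  distinct = Permutationₛ.Unique-resp-↭ (setoid _) (↭⇒↭ₛ (↭-sym (sort-↭ S))) unique

-- Lower bound

side-nonZero : ∀ d → NonZero (side d)
side-nonZero zero    = _
side-nonZero (suc d) = m*n≢0 (side d) (side d) {{side-nonZero d}} {{side-nonZero d}}

fromDigits : ℕ → ℕ → ℕ → ℕ
fromDigits N q m = m + q * N

module _ {N : ℕ} where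

  fromDigits-< : ∀ {q m} → q < N → m < N → fromDigits N q m < N * N
  fromDigits-< {q} q<N m<N = ≤-trans (+-monoˡ-< (q * N) m<N) (*-monoˡ-≤ N q<N)

  fromDigits-≤⇒high-≤ : ∀ {q m q′ m′} → m′ < N → fromDigits N q m ≤ fromDigits N q′ m′ → q ≤ q′
  fromDigits-≤⇒high-≤ {q} {m} {q′} {m′} m′<N le = ≮⇒≥ λ q′<q → <⇒≱ (begin-strict
    m′ + q′ * N  <⟨ +-monoˡ-< (q′ * N) m′<N ⟩
    suc q′ * N   ≤⟨ *-monoˡ-≤ N q′<q ⟩
    q * N        ≤⟨ m≤n+m (q * N) m ⟩
    m + q * N    ∎) le
    where open ≤-Reasoning

  Between-high-digits : ∀ {q₁ q₂ q₃ m₁ m₂ m₃} → m₁ < N → m₂ < N → m₃ < N →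
    Between (fromDigits N q₁ m₁) (fromDigits N q₂ m₂) (fromDigits N q₃ m₃) → Between q₁ q₂ q₃
  Between-high-digits m₁<N m₂<N m₃<N (inj₁ (≤₁₂ , ≤₂₃)) = inj₁ (fromDigits-≤⇒high-≤ m₂<N ≤₁₂ , fromDigits-≤⇒high-≤ m₃<N ≤₂₃)
  Between-high-digits m₁<N m₂<N m₃<N (inj₂ (≤₃₂ , ≤₂₁)) = inj₂ (fromDigits-≤⇒high-≤ m₂<N ≤₃₂ , fromDigits-≤⇒high-≤ m₁<N ≤₂₁)

  Between-low-digits : ∀ {q m₁ m₂ m₃} →
    Between (fromDigits N q m₁) (fromDigits N q m₂) (fromDigits N q m₃) → Between m₁ m₂ m₃
  Between-low-digits {q} (inj₁ (≤₁₂ , ≤₂₃)) = inj₁ (+-cancelʳ-≤ (q * N) _ _ ≤₁₂ , +-cancelʳ-≤ (q * N) _ _ ≤₂₃)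
  Between-low-digits {q} (inj₂ (≤₃₂ , ≤₂₁)) = inj₂ (+-cancelʳ-≤ (q * N) _ _ ≤₃₂ , +-cancelʳ-≤ (q * N) _ _ ≤₂₁)

  AllBetween-high-digits : ∀ {n} (qs₁ qs₂ qs₃ : Vec ℕ n) {ms₁ ms₂ ms₃} →
    All (_< N) ms₁ → All (_< N) ms₂ → All (_< N) ms₃ →
    AllBetween (zipWith (fromDigits N) qs₁ ms₁) (zipWith (fromDigits N) qs₂ ms₂) (zipWith (fromDigits N) qs₃ ms₃) →
    AllBetween qs₁ qs₂ qs₃
  AllBetween-high-digits []        []        []        []             []             []             _ = tt
  AllBetween-high-digits (_ ∷ qs₁) (_ ∷ qs₂) (_ ∷ qs₃) (m₁<N ∷ ms₁<N) (m₂<N ∷ ms₂<N) (m₃<N ∷ ms₃<N) (b , bs) =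
    Between-high-digits m₁<N m₂<N m₃<N b , AllBetween-high-digits qs₁ qs₂ qs₃ ms₁<N ms₂<N ms₃<N bs

  AllBetween-low-digits : ∀ {n} (qs ms₁ ms₂ ms₃ : Vec ℕ n) →
    AllBetween (zipWith (fromDigits N) qs ms₁) (zipWith (fromDigits N) qs ms₂) (zipWith (fromDigits N) qs ms₃) →
    AllBetween ms₁ ms₂ ms₃
  AllBetween-low-digits []       []        []        []        _        = tt
  AllBetween-low-digits (q ∷ qs) (_ ∷ ms₁) (_ ∷ ms₂) (_ ∷ ms₃) (b , bs) =
    Between-low-digits {q} b , AllBetween-low-digits qs ms₁ ms₂ ms₃ bs

  low-digit-≤ : ∀ {q q′ m₁ m₂ m₃} → q < q′ → m₂ < N →
    Between (fromDigits N q m₁) (fromDigits N q m₂) (fromDigits N q′ m₃) → m₁ ≤ m₂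
  low-digit-≤ {q} q<q′ m₂<N (inj₁ (≤₁₂ , _))   = +-cancelʳ-≤ (q * N) _ _ ≤₁₂
  low-digit-≤     q<q′ m₂<N (inj₂ (≤₃₂ , _))   = contradiction (fromDigits-≤⇒high-≤ m₂<N ≤₃₂) (<⇒≱ q<q′)

  low-digit-≥ : ∀ {q q′ m₁ m₂ m₃} → q′ < q → m₃ < N →
    Between (fromDigits N q m₁) (fromDigits N q m₂) (fromDigits N q′ m₃) → m₂ ≤ m₁
  low-digit-≥     q′<q m₃<N (inj₁ (_ , ≤₂₃)) = contradiction (fromDigits-≤⇒high-≤ m₃<N ≤₂₃) (<⇒≱ q′<q)
  low-digit-≥ {q} q′<q m₃<N (inj₂ (_ , ≤₂₁)) = +-cancelʳ-≤ (q * N) _ _ ≤₂₁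

  shared-high-digit : ∀ {q q′ m₁ m₂ m₃} → q ≢ q′ → q < N → q′ < N → m₂ < N → m₃ < N →
    Between (fromDigits N q m₁) (fromDigits N q m₂) (fromDigits N q′ m₃) →
    Between (fromDigits N (N ∸ 1 ∸ q) m₁) (fromDigits N (N ∸ 1 ∸ q) m₂) (fromDigits N (N ∸ 1 ∸ q′) m₃) →
    m₁ ≡ m₂
  shared-high-digit {q} {q′} q≢q′ q<N q′<N m₂<N m₃<N b b′ with <-cmp q q′
  ... | tri< q<q′ _ _ = ≤-antisym (low-digit-≤ q<q′ m₂<N b)
                                  (low-digit-≥ (∸-monoʳ-< q<q′ (suc[m]≤n⇒m≤pred[n] q′<N)) m₃<N b′)
  ... | tri≈ _ q≡q′ _ = contradiction q≡q′ q≢q′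
  ... | tri> _ _ q′<q = ≤-antisym (low-digit-≤ (∸-monoʳ-< q′<q (suc[m]≤n⇒m≤pred[n] q<N)) m₂<N b′)
                                  (low-digit-≥ q′<q m₃<N b)

pointTail : ∀ d → ℕ → Vec ℕ d
pointTail zero    t = []
pointTail (suc d) t = fromDigits N (N ∸ 1 ∸ q) m ∷ zipWith (fromDigits N) (pointTail d q) (pointTail d m)
  where
  N = side d
  instance _ = side-nonZero d
  q = t / N
  m = t % N

point : ∀ d → ℕ → Vec ℕ (suc d)
point d t = t ∷ pointTail d t

reflect-< : ∀ {N} q .{{_ : NonZero N}} → N ∸ 1 ∸ q < N
reflect-< {N} q = m≤pred[n]⇒suc[m]≤n (m∸n≤m (N ∸ 1) q)

zipWith-fromDigits-< : ∀ {n N} {qs ms : Vec ℕ n} → All (_< N) qs → All (_< N) ms →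
  All (_< N * N) (zipWith (fromDigits N) qs ms)
zipWith-fromDigits-< []             []             = []
zipWith-fromDigits-< (q<N ∷ qs<N) (m<N ∷ ms<N) = fromDigits-< q<N m<N ∷ zipWith-fromDigits-< qs<N ms<N

pointTail-< : ∀ d t → All (_< side d) (pointTail d t)
pointTail-< zero    t = []
pointTail-< (suc d) t = fromDigits-< (reflect-< (t / N)) (m%n<n t N)
  ∷ zipWith-fromDigits-< (pointTail-< d (t / N)) (pointTail-< d (t % N))
  where
  N = side d
  instance _ = side-nonZero d

BetweenFreeBelow : ∀ {n} → ℕ → (ℕ → Vec ℕ n) → Set
BetweenFreeBelow N f = ∀ {t₁ t₂ t₃} → t₁ < N → t₂ < N → t₃ < N → t₁ ≢ t₂ → t₁ ≢ t₃ → t₂ ≢ t₃ →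
  ¬ AllBetween (f t₁) (f t₂) (f t₃)

no-three-below-2 : ∀ {t₁ t₂ t₃} → t₁ < 2 → t₂ < 2 → t₃ < 2 → t₁ ≢ t₂ → t₁ ≢ t₃ → t₂ ≢ t₃ → ⊥
no-three-below-2 {0} {0} _ _ _ t₁≢t₂ _ _ = t₁≢t₂ refl
no-three-below-2 {1} {1} _ _ _ t₁≢t₂ _ _ = t₁≢t₂ refl
no-three-below-2 {0} {1} {0} _ _ _ _ t₁≢t₃ _ = t₁≢t₃ refl
no-three-below-2 {0} {1} {1} _ _ _ _ _ t₂≢t₃ = t₂≢t₃ refl
no-three-below-2 {1} {0} {0} _ _ _ _ _ t₂≢t₃ = t₂≢t₃ refl
no-three-below-2 {1} {0} {1} _ _ _ _ t₁≢t₃ _ = t₁≢t₃ refl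
no-three-below-2 {suc (suc _)} (s≤s (s≤s ())) _ _ _ _ _
no-three-below-2 {_} {suc (suc _)} _ (s≤s (s≤s ())) _ _ _ _
no-three-below-2 {_} {_} {suc (suc _)} _ _ (s≤s (s≤s ())) _ _ _

point-between-free-step : ∀ d → BetweenFreeBelow (side d) (point d) → BetweenFreeBelow (side (suc d)) (point (suc d))
point-between-free-step d between-free {t₁} {t₂} {t₃} t₁<N² t₂<N² t₃<N² t₁≢t₂ t₁≢t₃ t₂≢t₃ (b , b′ , bs) =
  in-digits (m≡m%n+[m/n]*n t₁ N) (m≡m%n+[m/n]*n t₂ N) (m≡m%n+[m/n]*n t₃ N)
    (m<n*o⇒m/o<n t₁<N²) (m<n*o⇒m/o<n t₂<N²) (m<n*o⇒m/o<n t₃<N²) (m%n<n t₁ N) (m%n<n t₂ N) (m%n<n t₃ N)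
    t₁≢t₂ t₁≢t₃ t₂≢t₃ b b′ bs
  where
  N = side d
  instance _ = side-nonZero d
  in-digits : ∀ {t₁ t₂ t₃ q₁ q₂ q₃ m₁ m₂ m₃} →
    t₁ ≡ fromDigits N q₁ m₁ → t₂ ≡ fromDigits N q₂ m₂ → t₃ ≡ fromDigits N q₃ m₃ →
    q₁ < N → q₂ < N → q₃ < N → m₁ < N → m₂ < N → m₃ < N → t₁ ≢ t₂ → t₁ ≢ t₃ → t₂ ≢ t₃ →
    Between t₁ t₂ t₃ →
    Between (fromDigits N (N ∸ 1 ∸ q₁) m₁) (fromDigits N (N ∸ 1 ∸ q₂) m₂) (fromDigits N (N ∸ 1 ∸ q₃) m₃) →
    AllBetween (zipWith (fromDigits N) (pointTail d q₁) (pointTail d m₁))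
               (zipWith (fromDigits N) (pointTail d q₂) (pointTail d m₂))
               (zipWith (fromDigits N) (pointTail d q₃) (pointTail d m₃)) →
    ⊥
  in-digits {q₁ = q₁} {q₂} {q₃} refl refl refl q₁<N q₂<N q₃<N m₁<N m₂<N m₃<N t₁≢t₂ t₁≢t₃ t₂≢t₃ b b′ bs
    with q₁ ≟ q₂ | q₂ ≟ q₃ | q₁ ≟ q₃
  ... | yes refl | yes refl | _ =
    between-free m₁<N m₂<N m₃<N (t₁≢t₂ ∘ cong (fromDigits N q₁)) (t₁≢t₃ ∘ cong (fromDigits N q₁))
      (t₂≢t₃ ∘ cong (fromDigits N q₁)) (Between-low-digits {q = q₁} b , AllBetween-low-digits _ _ _ _ bs)
  ... | yes refl | no q₂≢q₃ | _ =
    t₁≢t₂ (cong (fromDigits N q₁) (shared-high-digit q₂≢q₃ q₂<N q₃<N m₂<N m₃<N b b′))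
  ... | no q₁≢q₂ | yes refl | _ =
    t₂≢t₃ (cong (fromDigits N q₂)
      (sym (shared-high-digit (≢-sym q₁≢q₂) q₂<N q₁<N m₂<N m₁<N (Between-sym b) (Between-sym b′))))
  ... | no q₁≢q₂ | no _ | yes refl = q₁≢q₂ (sym (Between-outer-≡ (Between-high-digits m₁<N m₂<N m₃<N b)))
  ... | no q₁≢q₂ | no q₂≢q₃ | no q₁≢q₃ =
    between-free q₁<N q₂<N q₃<N q₁≢q₂ q₁≢q₃ q₂≢q₃
      (Between-high-digits m₁<N m₂<N m₃<N b ,
       AllBetween-high-digits _ _ _ (pointTail-< d _) (pointTail-< d _) (pointTail-< d _) bs)

point-between-free : ∀ d → BetweenFreeBelow (side d) (point d)
point-between-free zero    t₁<2 t₂<2 t₃<2 t₁≢t₂ t₁≢t₃ t₂≢t₃ _ = no-three-below-2 t₁<2 t₂<2 t₃<2 t₁≢t₂ t₁≢t₃ t₂≢t₃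
point-between-free (suc d) = point-between-free-step d (point-between-free d)

InGrid-bounded : ∀ {n N} {is v : Vec ℕ n} → All (N ≤_) is → All (_< N) v → InGrid is v
InGrid-bounded []           []           = tt
InGrid-bounded (N≤i ∷ N≤is) (x<N ∷ xs<N) = <-≤-trans x<N N≤i , InGrid-bounded N≤is xs<N

gp-lower : ∀ d {is : Vec ℕ (suc d)} → All (side d ≤_) is → ∃ λ S → IsGPSet is S × length S ≡ side d
gp-lower d {is} sides =
  S , BetweenFree⇒IsGPSet (ListAll.tabulate in-grid) (Unique.map⁺ (cong head) (Unique.upTo⁺ (side d))) between-free ,
  trans (length-map (point d) (upTo (side d))) (length-upTo (side d))
  where
  S = map (point d) (upTo (side d))
  index : ∀ {u} → u ∈ S → ∃ λ t → t < side d × u ≡ point d t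
  index u∈S = let t , t∈ , u≡ = ∈-map⁻ (point d) u∈S in t , ∈-upTo⁻ t∈ , u≡
  in-grid : ∀ {u} → u ∈ S → InGrid is u
  in-grid u∈S with index u∈S
  ... | t , t<N , refl = InGrid-bounded sides (t<N ∷ pointTail-< d t)
  between-free : BetweenFree S
  between-free u∈S w∈S v∈S u≢w u≢v w≢v with index u∈S | index w∈S | index v∈S
  ... | t₁ , t₁<N , refl | t₂ , t₂<N , refl | t₃ , t₃<N , refl =
    point-between-free d t₁<N t₂<N t₃<N (u≢w ∘ cong (point d)) (u≢v ∘ cong (point d)) (w≢v ∘ cong (point d))

gp≡side : ∀ d {is : Vec ℕ (suc d)} → All (side d ≤_) is → GpEq is (side d)
gp≡side d sides = gp-lower d sides , λ _ → gp-upper d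

-- Also true for n = 1; the hypothesis n ≥ 2 only excludes the one-vertex grid n = 0.
corollary3p1 : (n : ℕ) → 2 ≤ n → (is : Vec ℕ n) →
    All (λ i → 2 ^ (2 ^ (n ∸ 1)) ≤ i) is →
    GpEq is (2 ^ (2 ^ (n ∸ 1)))
corollary3p1 zero    ()
corollary3p1 (suc d) _  is = subst (λ N → All (N ≤_) is → GpEq is N) (side≡2^2^d d) (gp≡side d)
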